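{- Let $G = (V,E)$ be a finite graph with maximum degree at most $d$ and let $(\mathcal{X},\mathcal{T})$ be an edge-overlapping and minimal tree decomposition of $G$ of width $h$. Then every node of $\mathcal{T}$ has degree at most $d(h + 1)$ in $\mathcal T$.
   Context: A tree decomposition of $G$ is a pair $(\mathcal X,\mathcal T)$ where $\mathcal X=(X_1,\dots,X_m)$ is a family of subsets of $V$ and $\mathcal T$ is a tree or forest whose nodes are the $X_i$, such that: every vertex lies in some $X_i$; every edge has both endpoints in some $X_i$; for every $v\in V$ the nodes containing $v$ form a connected subset of $\mathcal T$. Its width is $\max_i|X_i|-1$. It is edge-overlapping if $X_i\cap X_j\ne\emptyset$ for every edge $(X_i,X_j)$ of $\mathcal T$; it is minimal if for every $X_i$ and every $x\in X_i$, removing $x$ from $X_i$ makes $(\mathcal X,\mathcal T)$ no longer a tree decomposition of $G$. -}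

module Defs where

open import Data.Nat using (ℕ; suc; _≤_)
open import Data.Bool using (Bool; true; false; if_then_else_)
open import Data.Fin using (Fin)
open import Data.Fin.Properties using () renaming (_≟_ to _≟ᶠ_)
open import Data.Fin.Subset using (Subset; _∈_; _∉_; ∣_∣; _─_; ⁅_⁆)
open import Data.Vec using (tabulate)
open import Data.List using (List; []; _∷_; _++_; [_]; length)
open import Data.List.Relation.Unary.Linked using (Linked)
open import Data.List.Relation.Unary.Unique.Propositional using (Unique)
open import Data.Product using (Σ; _×_; ∃; ∃-syntax)
open import Relation.Binary.PropositionalEquality using (_≡_)
open import Relation.Nullary using (¬_; does)

record Graph (n : ℕ) : Set where
  field
    adj     : Fin n → Fin n → Bool
    sym     : ∀ u v → adj u v ≡ adj v u
    irrefl  : ∀ v → adj v v ≡ false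
open Graph public

Adj : ∀ {n} → Graph n → Fin n → Fin n → Set
Adj G u v = adj G u v ≡ true

degree : ∀ {n} → Graph n → Fin n → ℕ
degree G v = ∣ tabulate (adj G v) ∣

MaxDegreeAtMost : ∀ {n} → Graph n → ℕ → Set
MaxDegreeAtMost G d = ∀ v → degree G v ≤ d

-- A cycle: pairwise distinct vertices x, y₁, ..., yₖ with k ≥ 2 (so at least
-- 3 vertices), consecutive ones adjacent, and the last adjacent to x.
IsCycle : ∀ {n} → Graph n → List (Fin n) → Set
IsCycle G [] = Data.Empty.⊥
  where import Data.Empty
IsCycle G (x ∷ ys) =
  2 ≤ length ys × Unique (x ∷ ys) × Linked (Adj G) (x ∷ ys ++ [ x ])

IsForest : ∀ {n} → Graph n → Set
IsForest G = ∀ xs → ¬ IsCycle G xs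

data WalkIn {n} (G : Graph n) (P : Fin n → Set) : Fin n → Fin n → Set where
  here : ∀ {i} → P i → WalkIn G P i i
  step : ∀ {i k j} → P i → Adj G i k → WalkIn G P k j → WalkIn G P i j

record IsTreeDecomposition {n m : ℕ} (G : Graph n) (X : Fin m → Subset n)
                           (T : Graph m) : Set where
  field
    forest    : IsForest T
    covers-v  : ∀ v → ∃[ i ] v ∈ X i
    covers-e  : ∀ u v → Adj G u v → ∃[ i ] (u ∈ X i × v ∈ X i)
    connected : ∀ v i j → v ∈ X i → v ∈ X j → WalkIn T (λ k → v ∈ X k) i j

-- Width h: max |Xᵢ| − 1 = h, i.e. all bags have size ≤ h+1 and some bag has
-- size exactly h+1.
HasWidth : ∀ {n m} → (Fin m → Subset n) → ℕ → Set
HasWidth X h = (∀ i → ∣ X i ∣ ≤ suc h) × (∃[ i ] ∣ X i ∣ ≡ suc h)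

EdgeOverlapping : ∀ {n m} → (Fin m → Subset n) → Graph m → Set
EdgeOverlapping X T = ∀ i j → Adj T i j → ∃[ v ] (v ∈ X i × v ∈ X j)

removeFrom : ∀ {n m} → (Fin m → Subset n) → Fin m → Fin n → Fin m → Subset n
removeFrom X i x j = if does (i ≟ᶠ j) then X j ─ ⁅ x ⁆ else X j

Minimal : ∀ {n m} → Graph n → (Fin m → Subset n) → Graph m → Set
Minimal G X T = ∀ i x → x ∈ X i → ¬ IsTreeDecomposition G (removeFrom X i x) T

-- For a tree neighbour j of i, edge-overlap gives v ∈ X i ∩ X j.  Follow the
-- subtree of bags containing v from i through j to a leaf k with parent p.
-- Minimality forbids deleting v from X k, and the only possible obstruction is
-- an edge vw with w ∈ X k ∖ X p, so w ∉ X i.  Distinct j yield distinct w, as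
-- otherwise the bags containing w would join two branches at i while avoiding
-- i.  Hence deg i ≤ |N(X i)| ≤ d |X i| ≤ d (h + 1).
module Submission where

open import Defs hiding (sym)
open import Data.Nat using (ℕ; zero; suc; _≤_; _*_; _+_; z≤n; s≤s)
open import Data.Nat.Properties
  using (≤-reflexive; ≤-trans; <-≤-trans; ≤-<-trans; +-mono-≤; +-monoʳ-≤; m≤m+n; +-suc; n≤1+n; *-comm; *-monoˡ-≤; <⇒≱; module ≤-Reasoning)
open import Data.Bool using (true)
open import Data.Bool.Properties using () renaming (_≟_ to _≟ᵇ_)
open import Data.Fin using (Fin; zero; suc)
open import Data.Fin.Properties using (any?; suc-injective; 0≢1+n) renaming (_≟_ to _≟ᶠ_)
open import Data.Fin.Subset
  using (Subset; inside; outside; _∈_; _∉_; _⊆_; _⊂_; ∣_∣; _∪_; _-_; ⁅_⁆; ⊥)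
open import Data.Fin.Subset.Properties
  using (_∈?_; ∉⊥; ∣⊥∣≡0; x∈⁅x⁆; x∈⁅y⁆⇒x≡y; x∈p∪q⁻; p⊆p∪q; q⊆p∪q; ∣p∣≤n; p⊂q⇒∣p∣<∣q∣;
         p─q⊆p; x∈p∧x≢y⇒x∈p-y; x∈p⇒∣p-x∣<∣p∣)
open import Data.Vec using ([]; _∷_; here; there; tabulate)
open import Data.Vec.Properties using (lookup∘tabulate; []=⇒lookup; lookup⇒[]=)
open import Data.List using (List; []; _∷_; _++_; [_]; length)
open import Data.List.Membership.Propositional using () renaming (_∈_ to _∈ₗ_; _∉_ to _∉ₗ_)
open import Data.List.Relation.Unary.Any using (here; there)
open import Data.List.Relation.Unary.All using (All; []; _∷_)
import Data.List.Relation.Unary.All as All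
open import Data.List.Relation.Unary.All.Properties using (¬Any⇒All¬)
open import Data.List.Relation.Unary.Linked using (Linked; [-]; _∷_)
open import Data.List.Relation.Unary.Unique.Propositional using (Unique)
open import Data.List.Relation.Unary.AllPairs using ([]; _∷_)
open import Data.Product using (Σ; _×_; _,_; proj₁; proj₂; ∃-syntax)
open import Data.Sum using (_⊎_; inj₁; inj₂)
open import Data.Unit using (⊤; tt)
open import Data.Empty using (⊥-elim)
open import Function using (_∘_)
open import Relation.Binary.PropositionalEquality using (_≡_; _≢_; refl; sym; trans; subst; ≢-sym)
open import Relation.Nullary using (¬_; yes; no; ¬?)
open import Relation.Nullary.Decidable using (_×-dec_; decidable-stable)

∣p∪q∣≤∣p∣+∣q∣ : ∀ {n} (p q : Subset n) → ∣ p ∪ q ∣ ≤ ∣ p ∣ + ∣ q ∣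
∣p∪q∣≤∣p∣+∣q∣ []            []            = z≤n
∣p∪q∣≤∣p∣+∣q∣ (inside  ∷ p) (inside  ∷ q) =
  s≤s (≤-trans (∣p∪q∣≤∣p∣+∣q∣ p q) (+-monoʳ-≤ ∣ p ∣ (n≤1+n ∣ q ∣)))
∣p∪q∣≤∣p∣+∣q∣ (inside  ∷ p) (outside ∷ q) = s≤s (∣p∪q∣≤∣p∣+∣q∣ p q)
∣p∪q∣≤∣p∣+∣q∣ (outside ∷ p) (inside  ∷ q) =
  ≤-trans (s≤s (∣p∪q∣≤∣p∣+∣q∣ p q)) (≤-reflexive (sym (+-suc ∣ p ∣ ∣ q ∣)))
∣p∪q∣≤∣p∣+∣q∣ (outside ∷ p) (outside ∷ q) = ∣p∪q∣≤∣p∣+∣q∣ p q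

injection⇒∣p∣≤∣q∣ : ∀ {k n} {p : Subset k} {q : Subset n}
                    (f : ∀ {x} → x ∈ p → Σ (Fin n) (_∈ q)) →
                    (∀ {x y} (x∈p : x ∈ p) (y∈p : y ∈ p) → proj₁ (f x∈p) ≡ proj₁ (f y∈p) → x ≡ y) →
                    ∣ p ∣ ≤ ∣ q ∣
injection⇒∣p∣≤∣q∣ {p = []}          f inj = z≤n
injection⇒∣p∣≤∣q∣ {p = outside ∷ p} f inj =
  injection⇒∣p∣≤∣q∣ {p = p} (f ∘ there) (λ x∈p y∈p → suc-injective ∘ inj (there x∈p) (there y∈p))
injection⇒∣p∣≤∣q∣ {p = inside ∷ p} {q} f inj =
  ≤-<-trans (injection⇒∣p∣≤∣q∣ {p = p} {q - y₀} f′ (λ x∈p y∈p → suc-injective ∘ inj (there x∈p) (there y∈p)))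
            (x∈p⇒∣p-x∣<∣p∣ (proj₂ (f here)))
  where
  y₀ : Fin _
  y₀ = proj₁ (f here)
  f′ : ∀ {x} → x ∈ p → Σ _ (_∈ q - y₀)
  f′ x∈p = proj₁ (f (there x∈p)) ,
           x∈p∧x≢y⇒x∈p-y (proj₂ (f (there x∈p))) (λ eq → 0≢1+n (inj here (there x∈p) (sym eq)))

unionOver : ∀ {k n} → Subset k → (Fin k → Subset n) → Subset n
unionOver []            F = ⊥
unionOver (inside  ∷ S) F = F zero ∪ unionOver S (F ∘ suc)
unionOver (outside ∷ S) F = unionOver S (F ∘ suc)

⊆-unionOver : ∀ {k n} (S : Subset k) (F : Fin k → Subset n) {x} → x ∈ S → F x ⊆ unionOver S F
⊆-unionOver (inside  ∷ S) F here        = p⊆p∪q _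
⊆-unionOver (inside  ∷ S) F (there x∈S) = q⊆p∪q (F zero) _ ∘ ⊆-unionOver S (F ∘ suc) x∈S
⊆-unionOver (outside ∷ S) F (there x∈S) = ⊆-unionOver S (F ∘ suc) x∈S

∣unionOver∣≤ : ∀ {k n} (S : Subset k) (F : Fin k → Subset n) {d} →
               (∀ x → ∣ F x ∣ ≤ d) → ∣ unionOver S F ∣ ≤ ∣ S ∣ * d
∣unionOver∣≤ {n = n} [] F ∣F∣≤d = ≤-reflexive (∣⊥∣≡0 n)
∣unionOver∣≤ (inside  ∷ S) F ∣F∣≤d =
  ≤-trans (∣p∪q∣≤∣p∣+∣q∣ (F zero) _) (+-mono-≤ (∣F∣≤d zero) (∣unionOver∣≤ S (F ∘ suc) (∣F∣≤d ∘ suc)))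
∣unionOver∣≤ (outside ∷ S) F ∣F∣≤d = ∣unionOver∣≤ S (F ∘ suc) (∣F∣≤d ∘ suc)

adj-sym : ∀ {n} (G : Graph n) {a b} → Adj G a b → Adj G b a
adj-sym G {a} {b} e = trans (Graph.sym G b a) e

adj-irrefl : ∀ {n} (G : Graph n) {a b} → Adj G a b → a ≢ b
adj-irrefl G {a} e refl with () ← trans (sym e) (irrefl G a)

neighbours : ∀ {n} → Graph n → Fin n → Subset n
neighbours G v = tabulate (adj G v)

neighbourhood : ∀ {n} → Graph n → Subset n → Subset n
neighbourhood G S = unionOver S (neighbours G)

module _ {n} (G : Graph n) where

  ∈neighbours⁺ : ∀ {v w} → Adj G v w → w ∈ neighbours G v
  ∈neighbours⁺ {v} {w} e = lookup⇒[]= w _ (trans (lookup∘tabulate (adj G v) w) e)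

  ∈neighbours⁻ : ∀ {v w} → w ∈ neighbours G v → Adj G v w
  ∈neighbours⁻ {v} {w} w∈ = trans (sym (lookup∘tabulate (adj G v) w)) ([]=⇒lookup w∈)

  ∈neighbourhood⁺ : ∀ {S v w} → v ∈ S → Adj G v w → w ∈ neighbourhood G S
  ∈neighbourhood⁺ {S} v∈S e = ⊆-unionOver S (neighbours G) v∈S (∈neighbours⁺ e)

  ∣neighbourhood∣≤ : ∀ {d} → MaxDegreeAtMost G d → ∀ S → ∣ neighbourhood G S ∣ ≤ ∣ S ∣ * d
  ∣neighbourhood∣≤ maxDeg S = ∣unionOver∣≤ S (neighbours G) maxDeg

fromList : ∀ {n} → List (Fin n) → Subset n
fromList []       = ⊥
fromList (x ∷ xs) = ⁅ x ⁆ ∪ fromList xs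

∈fromList⁻ : ∀ {n x} (xs : List (Fin n)) → x ∈ fromList xs → x ∈ₗ xs
∈fromList⁻ []       x∈ = ⊥-elim (∉⊥ x∈)
∈fromList⁻ (y ∷ xs) x∈ with x∈p∪q⁻ ⁅ y ⁆ (fromList xs) x∈
... | inj₁ x∈⁅y⁆ = here (x∈⁅y⁆⇒x≡y y x∈⁅y⁆)
... | inj₂ x∈xs  = there (∈fromList⁻ xs x∈xs)

length≤∣fromList∣ : ∀ {n} {xs : List (Fin n)} → Unique xs → length xs ≤ ∣ fromList xs ∣
length≤∣fromList∣ {xs = []}     []               = z≤n
length≤∣fromList∣ {xs = x ∷ xs} (x∉xs ∷ unique) =
  <-≤-trans (s≤s (length≤∣fromList∣ unique)) (p⊂q⇒∣p∣<∣q∣ fromList-xs⊂)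
  where
  fromList-xs⊂ : fromList xs ⊂ fromList (x ∷ xs)
  fromList-xs⊂ = q⊆p∪q ⁅ x ⁆ (fromList xs) , x , p⊆p∪q (fromList xs) (x∈⁅x⁆ x) ,
                 λ x∈ → All.lookup x∉xs (∈fromList⁻ xs x∈) refl

unique⇒length≤ : ∀ {n} {xs : List (Fin n)} → Unique xs → length xs ≤ n
unique⇒length≤ {xs = xs} unique = ≤-trans (length≤∣fromList∣ unique) (∣p∣≤n (fromList xs))

module _ {n} {G : Graph n} where
  open import Data.List.Membership.DecPropositional (_≟ᶠ_ {n}) using () renaming (_∈?_ to _∈ₗ?_)

  vertices : ∀ {P a b} → WalkIn G P a b → List (Fin n)
  vertices (here {i} _)     = [ i ]
  vertices (step {i} _ _ W) = i ∷ vertices W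

  all-vertices : ∀ {P a b} (W : WalkIn G P a b) → All P (vertices W)
  all-vertices (here p)     = p ∷ []
  all-vertices (step p _ W) = p ∷ all-vertices W

  start-satisfies : ∀ {P a b} → WalkIn G P a b → P a
  start-satisfies (here p)     = p
  start-satisfies (step p _ _) = p

  start∈vertices : ∀ {P a b} (W : WalkIn G P a b) → a ∈ₗ vertices W
  start∈vertices (here _)     = here refl
  start∈vertices (step _ _ _) = here refl

  end∈vertices : ∀ {P a b} (W : WalkIn G P a b) → b ∈ₗ vertices W
  end∈vertices (here _)     = here refl
  end∈vertices (step _ _ W) = there (end∈vertices W)

  1≤length-vertices : ∀ {P a b} (W : WalkIn G P a b) → 1 ≤ length (vertices W)
  1≤length-vertices (here _)     = s≤s z≤n
  1≤length-vertices (step _ _ _) = s≤s z≤n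

  mapWalk : ∀ {P Q : Fin n → Set} {a b} → (∀ {x} → P x → Q x) → WalkIn G P a b → WalkIn G Q a b
  mapWalk f (here p)     = here (f p)
  mapWalk f (step p e W) = step (f p) e (mapWalk f W)

  infixr 5 _++ʷ_
  _++ʷ_ : ∀ {P a b c} → WalkIn G P a b → WalkIn G P b c → WalkIn G P a c
  here _     ++ʷ V = V
  step p e W ++ʷ V = step p e (W ++ʷ V)

  reverseʷ : ∀ {P a b} → WalkIn G P a b → WalkIn G P b a
  reverseʷ (here p)     = here p
  reverseʷ (step p e W) = reverseʷ W ++ʷ step (start-satisfies W) (adj-sym G e) (here p)

  prefix : ∀ {P Q : Fin n → Set} {a b c} (W : WalkIn G P a b) →
           c ∈ₗ vertices W → All Q (vertices W) → WalkIn G Q a c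
  prefix (here _)     (here refl)  (q ∷ []) = here q
  prefix (step _ _ _) (here refl)  (q ∷ _)  = here q
  prefix (step _ e W) (there c∈W)  (q ∷ qs) = step q e (prefix W c∈W qs)

  suffix : ∀ {P a b c} (W : WalkIn G P c b) → a ∈ₗ vertices W → Unique (vertices W) →
           Σ (WalkIn G P a b) (Unique ∘ vertices)
  suffix W@(here _)     (here refl) unique = W , unique
  suffix W@(step _ _ _) (here refl) unique = W , unique
  suffix (step _ _ W) (there a∈W)  (_ ∷ unique) = suffix W a∈W unique

  simplify : ∀ {P a b} → WalkIn G P a b → Σ (WalkIn G P a b) (Unique ∘ vertices)
  simplify (here p) = here p , [] ∷ []
  simplify (step {a} p e W) with simplify W
  ... | U , unique with a ∈ₗ? vertices U
  ...   | yes a∈U = suffix U a∈U unique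
  ...   | no  a∉U = step p e U , ¬Any⇒All¬ (vertices U) a∉U ∷ unique

  vertices-linked : ∀ {P a b c} (W : WalkIn G P a b) → Adj G b c → Linked (Adj G) (vertices W ++ [ c ])
  vertices-linked (here _)                e′ = e′ ∷ [-]
  vertices-linked (step _ e (here _))     e′ = e ∷ e′ ∷ [-]
  vertices-linked (step _ e W@(step _ _ _)) e′ = e ∷ vertices-linked W e′

forest⇒no-detour : ∀ {m} {T : Graph m} → IsForest T → ∀ {k a b} →
                   Adj T k a → Adj T k b → a ≢ b → ¬ WalkIn T (_≢ k) a b
forest⇒no-detour {T = T} forest {k} eka ekb a≢b W with simplify W
... | here _ , _ = a≢b refl
... | U@(step _ _ U′) , unique =
  forest (k ∷ vertices U)
    ( s≤s (1≤length-vertices U′)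
    , All.map ≢-sym (all-vertices U) ∷ unique
    , eka ∷ vertices-linked U (adj-sym T ekb))

x∉p-x : ∀ {n} (p : Subset n) x → x ∉ p - x
x∉p-x (_ ∷ p) zero    ()
x∉p-x (_ ∷ p) (suc x) (there x∈p-x) = x∉p-x p x x∈p-x

module RemoveFrom {n m} (X : Fin m → Subset n) (k : Fin m) (v : Fin n) where

  removeFrom-⊆ : ∀ {l x} → x ∈ removeFrom X k v l → x ∈ X l
  removeFrom-⊆ {l} x∈ with k ≟ᶠ l
  ... | yes _ = p─q⊆p (X l) ⁅ v ⁆ x∈
  ... | no  _ = x∈

  removeFrom-otherBag : ∀ {l x} → l ≢ k → x ∈ X l → x ∈ removeFrom X k v l
  removeFrom-otherBag {l} l≢k x∈ with k ≟ᶠ l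
  ... | yes k≡l = ⊥-elim (l≢k (sym k≡l))
  ... | no  _   = x∈

  removeFrom-otherVertex : ∀ {l x} → x ≢ v → x ∈ X l → x ∈ removeFrom X k v l
  removeFrom-otherVertex {l} x≢v x∈ with k ≟ᶠ l
  ... | yes _ = x∈p∧x≢y⇒x∈p-y x∈ x≢v
  ... | no  _ = x∈

  removeFrom-survives : ∀ {l x} → x ∈ X l → x ∈ removeFrom X k v l ⊎ (l ≡ k × x ≡ v)
  removeFrom-survives {l} {x} x∈l with l ≟ᶠ k | x ≟ᶠ v
  ... | no l≢k  | _       = inj₁ (removeFrom-otherBag l≢k x∈l)
  ... | yes _   | no x≢v  = inj₁ (removeFrom-otherVertex x≢v x∈l)
  ... | yes l≡k | yes x≡v = inj₂ (l≡k , x≡v)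

  removeFrom-removes : v ∉ removeFrom X k v k
  removeFrom-removes with k ≟ᶠ k
  ... | yes _   = x∉p-x (X k) v
  ... | no  k≢k = ⊥-elim (k≢k refl)

module _ {n m} {G : Graph n} {X : Fin m → Subset n} {T : Graph m}
         (td : IsTreeDecomposition G X T) where
  open IsTreeDecomposition td

  LeafOfSubtree : Fin n → Fin m → Fin m → Set
  LeafOfSubtree v par k = ∀ {k′} → Adj T k k′ → v ∈ X k′ → k′ ≡ par

  bag-walk : ∀ {w a b c} → w ∈ X a → w ∈ X b → w ∉ X c → WalkIn T (_≢ c) a b
  bag-walk {w} {a} {b} w∈a w∈b w∉c = mapWalk (λ { w∈x refl → w∉c w∈x }) (connected w a b w∈a w∈b)

  -- If w were in X i, the bags containing w would join k to i avoiding par,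
  -- and R would close this into a cycle through par.
  bag-separation : ∀ {P : Fin m → Set} {par k i w} → Adj T par k →
                   (R : WalkIn T P par i) → Unique (vertices R) → k ∉ₗ vertices R →
                   w ∈ X k → w ∉ X par → w ∉ X i
  bag-separation _   (here _)     _           _   _   w∉par = w∉par
  bag-separation epk (step _ e R) (par∉R ∷ _) k∉R w∈k w∉par w∈i =
    forest⇒no-detour forest epk e (λ { refl → k∉R (there (start∈vertices R)) })
      (bag-walk w∈k w∈i w∉par ++ʷ reverseʷ (prefix R (end∈vertices R) (All.map ≢-sym par∉R)))

  module _ {par k : Fin m} {v : Fin n} (par≢k : par ≢ k) (v∈par : v ∈ X par)
           (leaf : LeafOfSubtree v par k)
           (covered : ∀ {w} → Adj G v w → w ∈ X k → w ∈ X par) where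

    open RemoveFrom X k v

    private
      X′ : Fin m → Subset n
      X′ = removeFrom X k v

      ∈X′-par : ∀ {x} → x ∈ X par → x ∈ X′ par
      ∈X′-par = removeFrom-otherBag par≢k

      -- A walk through k enters and leaves it via par, the only neighbour of
      -- k whose bag contains v, so the visit to k can be cut out.
      bypass : ∀ {a b} → WalkIn T (λ x → v ∈ X x) a b → a ≢ k → b ≢ k →
               WalkIn T (λ x → v ∈ X x × x ≢ k) a b
      bypass (here p) a≢k _ = here (p , a≢k)
      bypass (step {_} {c} p e W) a≢k b≢k with c ≟ᶠ k
      ... | no c≢k = step (p , a≢k) e (bypass W c≢k b≢k)
      ... | yes refl with W
      ...   | here _ = ⊥-elim (b≢k refl)
      ...   | step q e′ W′ with trans (leaf e′ (start-satisfies W′)) (sym (leaf (adj-sym T e) p))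
      ...     | refl = bypass W′ a≢k b≢k

    remove-leaf-occurrence : IsTreeDecomposition G X′ T
    remove-leaf-occurrence = record
      { forest = forest ; covers-v = covers-v′ ; covers-e = covers-e′ ; connected = connected′ }
      where
      covers-v′ : ∀ u → ∃[ l ] u ∈ X′ l
      covers-v′ u with covers-v u
      ... | l , u∈l with removeFrom-survives u∈l
      ...   | inj₁ u∈′l          = l , u∈′l
      ...   | inj₂ (refl , refl) = par , ∈X′-par v∈par

      covers-e′ : ∀ u w → Adj G u w → ∃[ l ] (u ∈ X′ l × w ∈ X′ l)
      covers-e′ u w e with covers-e u w e
      ... | l , u∈l , w∈l with removeFrom-survives u∈l | removeFrom-survives w∈l
      ...   | inj₁ u∈′l          | inj₁ w∈′l          = l , u∈′l , w∈′l
      ...   | inj₂ (refl , refl) | _                  = par , ∈X′-par v∈par , ∈X′-par (covered e w∈l)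
      ...   | inj₁ _             | inj₂ (refl , refl) =
        par , ∈X′-par (covered (adj-sym G e) u∈l) , ∈X′-par v∈par

      connected′ : ∀ u a b → u ∈ X′ a → u ∈ X′ b → WalkIn T (λ l → u ∈ X′ l) a b
      connected′ u a b u∈a u∈b with u ≟ᶠ v | connected u a b (removeFrom-⊆ u∈a) (removeFrom-⊆ u∈b)
      ... | no u≢v | W = mapWalk (removeFrom-otherVertex u≢v) W
      ... | yes refl | W =
        mapWalk (λ (u∈x , x≢k) → removeFrom-otherBag x≢k u∈x)
          (bypass W (λ { refl → removeFrom-removes u∈a }) (λ { refl → removeFrom-removes u∈b }))

  private-neighbour : Minimal G X T → ∀ {par k v} → par ≢ k → v ∈ X par → v ∈ X k →
                      LeafOfSubtree v par k → ∃[ w ] (Adj G v w × w ∈ X k × w ∉ X par)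
  private-neighbour minimal {par} {k} {v} par≢k v∈par v∈k leaf
    with any? (λ w → (adj G v w ≟ᵇ true) ×-dec (w ∈? X k) ×-dec ¬? (w ∈? X par))
  ... | yes found = found
  ... | no none   = ⊥-elim (minimal k v v∈k (remove-leaf-occurrence par≢k v∈par leaf covered))
    where
    covered : ∀ {w} → Adj G v w → w ∈ X k → w ∈ X par
    covered {w} e w∈k = decidable-stable (w ∈? X par) λ w∉par → none (w , e , w∈k , w∉par)

  record BranchWitness (i j : Fin m) : Set where
    field
      vertex    : Fin n
      near-i    : vertex ∈ neighbourhood G (X i)
      outside-i : vertex ∉ X i
      node      : Fin m
      at-node   : vertex ∈ X node
      route     : WalkIn T (_≢ i) j node
  open BranchWitness

  branchWitness-injective : ∀ {i j₁ j₂} → Adj T i j₁ → Adj T i j₂ →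
                            (b₁ : BranchWitness i j₁) (b₂ : BranchWitness i j₂) →
                            vertex b₁ ≡ vertex b₂ → j₁ ≡ j₂
  branchWitness-injective {i} {j₁} {j₂} e₁ e₂ b₁ b₂ w₁≡w₂ with j₁ ≟ᶠ j₂
  ... | yes j₁≡j₂ = j₁≡j₂
  ... | no  j₁≢j₂ = ⊥-elim (forest⇒no-detour forest e₁ e₂ j₁≢j₂
          (route b₁ ++ʷ bag-walk (at-node b₁) at-node₂ (outside-i b₁) ++ʷ reverseʷ (route b₂)))
    where
    at-node₂ : vertex b₁ ∈ X (node b₂)
    at-node₂ = subst (_∈ X (node b₂)) (sym w₁≡w₂) (at-node b₂)

  module _ (minimal : Minimal G X T) {i : Fin m} {v : Fin n} (v∈i : v ∈ X i) where

    next-or-leaf : ∀ par k → (∃[ k′ ] (Adj T k k′ × k′ ≢ par × v ∈ X k′))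
                             ⊎ LeafOfSubtree v par k
    next-or-leaf par k with any? (λ k′ → (adj T k k′ ≟ᵇ true) ×-dec ¬? (k′ ≟ᶠ par) ×-dec (v ∈? X k′))
    ... | yes next = inj₁ next
    ... | no  none = inj₂ λ {k′} e v∈k′ →
                       decidable-stable (k′ ≟ᶠ par) λ k′≢par → none (k′ , e , k′≢par , v∈k′)

    witness-at-leaf : ∀ {par k j} (R : WalkIn T (λ _ → ⊤) par i) → Unique (vertices R) →
                      k ∉ₗ vertices R → Adj T par k → v ∈ X par → v ∈ X k →
                      LeafOfSubtree v par k → WalkIn T (_≢ i) j k → BranchWitness i j
    witness-at-leaf R unique k∉R epk v∈par v∈k leaf S
      with private-neighbour minimal (adj-irrefl T epk) v∈par v∈k leaf
    ... | w , evw , w∈k , w∉par = record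
      { vertex    = w
      ; near-i    = ∈neighbourhood⁺ G v∈i evw
      ; outside-i = bag-separation epk R unique k∉R w∈k w∉par
      ; node      = _
      ; at-node   = w∈k
      ; route     = S
      }

    -- Move away from i through bags containing v until k is a leaf of the
    -- subtree of v.  R, the way back to i, stays a path because T is a
    -- forest, so its length (at most m) bounds the descent.
    descend : ∀ {par k j} (fuel : ℕ) (R : WalkIn T (λ _ → ⊤) par i) →
              m ≤ fuel + length (vertices R) → Unique (vertices R) → k ∉ₗ vertices R →
              Adj T par k → v ∈ X par → v ∈ X k → WalkIn T (_≢ i) j k → BranchWitness i j
    descend zero R bound unique k∉R _ _ _ _ =
      ⊥-elim (<⇒≱ (unique⇒length≤ (¬Any⇒All¬ _ k∉R ∷ unique)) bound)
    descend {par} {k} (suc fuel) R bound unique k∉R epk v∈par v∈k S with next-or-leaf par k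
    ... | inj₂ leaf = witness-at-leaf R unique k∉R epk v∈par v∈k leaf S
    ... | inj₁ (k′ , ekk′ , k′≢par , v∈k′) =
      descend fuel (step tt (adj-sym T epk) R)
        (≤-trans bound (≤-reflexive (sym (+-suc fuel (length (vertices R))))))
        (¬Any⇒All¬ _ k∉R ∷ unique) k′∉kR ekk′ v∈k v∈k′ (S ++ʷ step k≢i ekk′ (here k′≢i))
      where
      k′∉kR : k′ ∉ₗ k ∷ vertices R
      k′∉kR (here refl)  = adj-irrefl T ekk′ refl
      k′∉kR (there k′∈R) = forest⇒no-detour forest (adj-sym T epk) ekk′ (≢-sym k′≢par)
                             (prefix R k′∈R (All.map ≢-sym (¬Any⇒All¬ _ k∉R)))
      k≢i : k ≢ i
      k≢i refl = k∉R (end∈vertices R)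
      k′≢i : k′ ≢ i
      k′≢i refl = k′∉kR (there (end∈vertices R))

  branch-witness : Minimal G X T → EdgeOverlapping X T → ∀ {i j} → Adj T i j → BranchWitness i j
  branch-witness minimal overlapping {i} {j} eij with overlapping i j eij
  ... | v , v∈i , v∈j =
    descend minimal v∈i m (here tt) (m≤m+n m 1) ([] ∷ []) (λ { (here refl) → adj-irrefl T eij refl })
      eij v∈i v∈j (here (≢-sym (adj-irrefl T eij)))

lemma5 : ∀ {n m : ℕ} (d h : ℕ) (G : Graph n) (X : Fin m → Subset n) (T : Graph m)
         → MaxDegreeAtMost G d
         → IsTreeDecomposition G X T
         → HasWidth X h
         → EdgeOverlapping X T
         → Minimal G X T
         → ∀ (i : Fin m) → degree T i ≤ d * suc h
lemma5 {n} d h G X T maxDeg td (bags≤ , _) overlapping minimal i = begin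
  degree T i                  ≤⟨ injection⇒∣p∣≤∣q∣ witness injective ⟩
  ∣ neighbourhood G (X i) ∣   ≤⟨ ∣neighbourhood∣≤ G maxDeg (X i) ⟩
  ∣ X i ∣ * d                 ≤⟨ *-monoˡ-≤ d (bags≤ i) ⟩
  suc h * d                   ≡⟨ *-comm (suc h) d ⟩
  d * suc h                   ∎
  where
  open ≤-Reasoning
  witnessOf : ∀ {j} → j ∈ neighbours T i → BranchWitness td i j
  witnessOf j∈ = branch-witness td minimal overlapping (∈neighbours⁻ T j∈)
  witness : ∀ {j} → j ∈ neighbours T i → Σ (Fin n) (_∈ neighbourhood G (X i))
  witness j∈ = BranchWitness.vertex (witnessOf j∈) , BranchWitness.near-i (witnessOf j∈)
  injective : ∀ {j₁ j₂} (j₁∈ : j₁ ∈ neighbours T i) (j₂∈ : j₂ ∈ neighbours T i) →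
              proj₁ (witness j₁∈) ≡ proj₁ (witness j₂∈) → j₁ ≡ j₂
  injective j₁∈ j₂∈ = branchWitness-injective td (∈neighbours⁻ T j₁∈) (∈neighbours⁻ T j₂∈)
                                                (witnessOf j₁∈) (witnessOf j₂∈)
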